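{- Let $\lambda$ be a partition and let $k\geq 3$ be an integer. If $1\leq \ell(\lambda)\leq k-2$ and $\lambda\neq (1),(2),(1,1)$, then \[ \frac{s_\lambda(1^k)}{k}\geq \frac{s_\lambda(1^{k-1})}{k-1}+1. \]
   Context: For a partition $\lambda$, $\ell(\lambda)$ denotes its number of nonzero parts. A semistandard Young tableau of shape $\lambda$ is a filling of the Young diagram of $\lambda$ with positive integers such that rows weakly increase from left to right and columns strictly increase from top to bottom. $s_\lambda(1^m)$ denotes the Schur polynomial $s_\lambda$ evaluated at $m$ ones, i.e. the number of semistandard Young tableaux of shape $\lambda$ with entries in $\{1,\dots,m\}$ (equivalently, $\dim S_\lambda\mathbf{C}^m$). -}

module Defs where

open import Data.Nat using (ℕ; zero; suc; _≤_; _<_; _≥_; _≤ᵇ_; _<ᵇ_)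
open import Data.Bool using (Bool; true; false; _∧_)
open import Data.List using (List; []; _∷_; map; concatMap; length; filter; zip; upTo)
open import Data.List.Relation.Unary.All using (All)
open import Data.List.Relation.Unary.Linked using (Linked)
open import Data.Product using (_×_; _,_)
open import Relation.Nullary.Decidable using (yes; no)
open import Relation.Binary.PropositionalEquality using (_≡_)

record Partition : Set where
  constructor mkPartition
  field
    parts      : List ℕ
    positive   : All (λ p → 1 ≤ p) parts
    decreasing : Linked _≥_ parts
open Partition public

len : Partition → ℕ
len λp = length (parts λp)

words : ℕ → ℕ → List (List ℕ)
words m zero    = [] ∷ []
words m (suc r) = concatMap (λ x → map (x ∷_) (words m r)) (map suc (upTo m))

-- all fillings of the Young diagram with row lengths given by the list,
-- entries in {1,…,m}; a filling is the list of its rows (top to bottom)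
fillings : ℕ → List ℕ → List (List (List ℕ))
fillings m []       = [] ∷ []
fillings m (r ∷ rs) = concatMap (λ w → map (w ∷_) (fillings m rs)) (words m r)

allᵇ : {A : Set} → (A → Bool) → List A → Bool
allᵇ p []       = true
allᵇ p (x ∷ xs) = p x ∧ allᵇ p xs

rowWeak : List ℕ → Bool
rowWeak []           = true
rowWeak (x ∷ [])     = true
rowWeak (x ∷ y ∷ xs) = (x ≤ᵇ y) ∧ rowWeak (y ∷ xs)

-- columns strictly increase: entry in row i below entry in row i+1 in the same column
-- (zip truncates to the shorter, i.e. lower, row)
colStrict : List (List ℕ) → Bool
colStrict []             = true
colStrict (r ∷ [])       = true
colStrict (r ∷ s ∷ rows) =
  allᵇ (λ { (a , b) → a <ᵇ b }) (zip r s) ∧ colStrict (s ∷ rows)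

isSSYT : List (List ℕ) → Bool
isSSYT t = allᵇ rowWeak t ∧ colStrict t

-- s_λ(1^m): the number of semistandard Young tableaux of shape λ with entries in {1,…,m}
schurOnes : Partition → ℕ → ℕ
schurOnes λp m = length (filter (λ t → isSSYT t Data.Bool.≟ true) (fillings m (parts λp)))

-- Write k = m + 1 and let SSYT(k) be the semistandard tableaux of shape λ with entries in
-- {1,…,k}.  For T ∈ SSYT(k) let d(T) be the number of distinct entries of T.  Relabelling by
-- the order-preserving bijection {1,…,m} ≅ {1,…,k} ∖ {j} shows that for each j exactly
-- s_λ(1^m) tableaux avoid j, so counting pairs (T, j) with j ∉ T gives
--   Σ_T (k − d(T)) = k s_λ(1^m),   i.e.   (k − 1) s_λ(1^k) = k s_λ(1^m) + Σ_T (d(T) − 1).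
-- It remains to find tableaux with large total excess Σ (d(T) − 1) ≥ k(k − 1).  Each n-subset
-- c₁ < ⋯ < cₙ of {1,…,k} yields a tableau using exactly these values, injectively in c:
-- rows constant equal to c₁,…,c_ℓ (n = ℓ), or a first row c₁⋯c₁c₂⋯c₂ followed by
-- constant rows c₃,…,c_{ℓ+1} (n = ℓ + 1).  For ℓ ≥ 3 the first family alone gives
-- C(k,ℓ)(ℓ − 1) ≥ k(k − 1); for ℓ = 2 both families give C(k,2) + 2C(k,3) ≥ k(k − 1);
-- for ℓ = 1 two disjoint variants of the second family give 2C(k,2) = k(k − 1).
module Submission where

open import Defs
open import Algebra.Properties.CommutativeSemigroup using (interchange; x∙yz≈y∙xz)
open import Data.Bool using (Bool; true; false; _∧_; if_then_else_)
import Data.Bool as Bool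
open import Data.Bool.Properties using (T-≡)
open import Data.Empty using (⊥-elim)
open import Data.List
  using (List; []; _∷_; _++_; map; concatMap; filter; length; replicate; zip; zipWith; upTo)
open import Data.List.Properties
  using (∷-injectiveˡ; ∷-injectiveʳ; map-injective; map-∘; map-cong; map-cong-local; map-++; map-upTo;
         length-map; length-upTo; length-replicate; length-++; filter-++; filter-all; filter-none; filter-≐)
open import Data.List.Membership.Propositional using (_∈_; find)
open import Data.List.Membership.Propositional.Properties
  using (∈-map⁺; ∈-map⁻; ∈-++⁺ˡ; ∈-++⁺ʳ; ∈-++⁻; ∈-∃++; ∈-concatMap⁺; ∈-concatMap⁻; map∷⁻;
         ∈-filter⁺; ∈-filter⁻; ∈-upTo⁻)
open import Data.List.Relation.Binary.Disjoint.Propositional using (Disjoint)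
open import Data.List.Relation.Binary.Subset.Propositional using (_⊆_)
open import Data.List.Relation.Unary.All as All using (All; []; _∷_; all?)
import Data.List.Relation.Unary.All.Properties as All
open import Data.List.Relation.Unary.All.Properties using (All¬⇒¬Any)
open import Data.List.Relation.Unary.AllPairs as AllPairs using ([]; _∷_)
open import Data.List.Relation.Unary.Any as Any using (Any; here; there)
open import Data.List.Relation.Unary.Linked as Linked using (Linked; []; [-]; _∷_)
import Data.List.Relation.Unary.Linked.Properties as Linked
open import Data.List.Relation.Unary.Linked.Properties using (Linked⇒AllPairs)
open import Data.List.Relation.Unary.Unique.Propositional using (Unique)
import Data.List.Relation.Unary.Unique.Propositional.Properties as Unique
open import Data.Nat
  using (ℕ; zero; suc; _+_; _*_; _∸_; _≤_; _<_; _≥_; _≤ᵇ_; _<ᵇ_; z≤n; s≤s; s<s;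
         _≤′_; ≤′-refl; ≤′-reflexive; ≤′-step)
open import Data.Nat.Combinatorics using (_C_; nC1≡n; nCk+nC[k+1]≡[n+1]C[k+1]; nCk≡nC[n∸k])
open import Data.Nat.ListAction using (sum)
open import Data.Nat.ListAction.Properties using (sum-++)
open import Data.Nat.Properties
open import Data.Product using (∃₂; _×_; _,_; proj₁; proj₂)
open import Data.Sum using (inj₁; inj₂; [_,_])
open import Function using (_∘_)
open import Function.Bundles using (Equivalence)
open import Relation.Binary.PropositionalEquality hiding ([_])
open import Relation.Nullary using (¬_; Dec; yes; no; does; ¬?)
open import Relation.Unary using (Decidable)
open import Relation.Unary.Properties using (∁?)

module _ {A : Set} where

  sum-map-+ : (f g : A → ℕ) (xs : List A) →
              sum (map (λ x → f x + g x) xs) ≡ sum (map f xs) + sum (map g xs)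
  sum-map-+ f g []       = refl
  sum-map-+ f g (x ∷ xs) =
    trans (cong (f x + g x +_) (sum-map-+ f g xs)) (interchange +-commutativeSemigroup (f x) (g x) _ _)

  sum-map-const : (c : ℕ) (xs : List A) → sum (map (λ _ → c) xs) ≡ length xs * c
  sum-map-const c []       = refl
  sum-map-const c (x ∷ xs) = cong (c +_) (sum-map-const c xs)

  length*≤sum-map : (f : A → ℕ) {w : ℕ} {xs : List A} →
                    (∀ {x} → x ∈ xs → w ≤ f x) → length xs * w ≤ sum (map f xs)
  length*≤sum-map f {xs = []}     w≤f = z≤n
  length*≤sum-map f {xs = x ∷ xs} w≤f =
    +-mono-≤ (w≤f (here refl)) (length*≤sum-map f (w≤f ∘ there))

  sum-map-mono-⊆ : (f : A → ℕ) {xs ys : List A} → Unique xs → xs ⊆ ys →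
                   sum (map f xs) ≤ sum (map f ys)
  sum-map-mono-⊆ f {[]}     _                  _    = z≤n
  sum-map-mono-⊆ f {x ∷ xs} (x≢xs ∷ xs-unique) x∷xs⊆ys with ∈-∃++ (x∷xs⊆ys (here refl))
  ... | as , bs , refl = begin
    f x + sum (map f xs)         ≤⟨ +-monoʳ-≤ (f x) (sum-map-mono-⊆ f xs-unique xs⊆as++bs) ⟩
    f x + sum (map f (as ++ bs)) ≡⟨ sum-map-++-∷ ⟨
    sum (map f (as ++ x ∷ bs))   ∎
    where
    open ≤-Reasoning
    xs⊆as++bs : xs ⊆ as ++ bs
    xs⊆as++bs {y} y∈xs with ∈-++⁻ as (x∷xs⊆ys (there y∈xs))
    ... | inj₁ y∈as         = ∈-++⁺ˡ y∈as
    ... | inj₂ (here refl)  = ⊥-elim (All.lookup x≢xs y∈xs refl)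
    ... | inj₂ (there y∈bs) = ∈-++⁺ʳ as y∈bs
    sum-map-++-∷ : sum (map f (as ++ x ∷ bs)) ≡ f x + sum (map f (as ++ bs))
    sum-map-++-∷ = begin-equality
      sum (map f (as ++ x ∷ bs))
        ≡⟨ cong sum (map-++ f as (x ∷ bs)) ⟩
      sum (map f as ++ map f (x ∷ bs))
        ≡⟨ sum-++ (map f as) _ ⟩
      sum (map f as) + (f x + sum (map f bs))
        ≡⟨ x∙yz≈y∙xz +-commutativeSemigroup (sum (map f as)) (f x) (sum (map f bs)) ⟩
      f x + (sum (map f as) + sum (map f bs))
        ≡⟨ cong (f x +_) (sum-++ (map f as) _) ⟨
      f x + sum (map f as ++ map f bs)
        ≡⟨ cong (λ zs → f x + sum zs) (map-++ f as bs) ⟨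
      f x + sum (map f (as ++ bs)) ∎

  length-mono-⊆ : {xs ys : List A} → Unique xs → xs ⊆ ys → length xs ≤ length ys
  length-mono-⊆ {xs} {ys} xs-unique xs⊆ys = subst₂ _≤_ (count-ones xs) (count-ones ys)
    (sum-map-mono-⊆ (λ _ → 1) xs-unique xs⊆ys)
    where
    count-ones : ∀ zs → sum (map (λ _ → 1) zs) ≡ length zs
    count-ones zs = trans (sum-map-const 1 zs) (*-identityʳ (length zs))

  Unique-map⁺ : {B : Set} {P : A → Set} {f : A → B} {xs : List A} → All P xs →
                (∀ {x y} → P x → P y → f x ≡ f y → x ≡ y) → Unique xs → Unique (map f xs)
  Unique-map⁺ []         f-inj []                  = []
  Unique-map⁺ (px ∷ pxs) f-inj (x≢xs ∷ xs-unique) =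
    All.map⁺ (All.zipWith (λ (x≢y , py) fx≡fy → x≢y (f-inj px py fx≡fy)) (x≢xs , pxs))
    ∷ Unique-map⁺ pxs f-inj xs-unique

module _ {A : Set} {P : A → Set} (P? : Decidable P) where

  indicator : A → ℕ
  indicator x = if does (P? x) then 1 else 0

  length-filter-∷ : ∀ x xs → length (filter P? (x ∷ xs)) ≡ indicator x + length (filter P? xs)
  length-filter-∷ x xs with does (P? x)
  ... | true  = refl
  ... | false = refl

  sum-map-indicator : ∀ xs → sum (map indicator xs) ≡ length (filter P? xs)
  sum-map-indicator []       = refl
  sum-map-indicator (x ∷ xs) =
    trans (cong (indicator x +_) (sum-map-indicator xs)) (sym (length-filter-∷ x xs))

  length-filter-∁ : ∀ xs → length (filter P? xs) + length (filter (∁? P?) xs) ≡ length xs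
  length-filter-∁ []       = refl
  length-filter-∁ (x ∷ xs) with does (P? x)
  ... | true  = cong suc (length-filter-∁ xs)
  ... | false = trans (+-suc _ _) (cong suc (length-filter-∁ xs))

  filter-map : {B : Set} (f : B → A) (xs : List B) → filter P? (map f xs) ≡ map f (filter (P? ∘ f) xs)
  filter-map f []       = refl
  filter-map f (x ∷ xs) with does (P? (f x))
  ... | true  = cong (f x ∷_) (filter-map f xs)
  ... | false = filter-map f xs

  filter-comm : {Q : A → Set} (Q? : Decidable Q) (xs : List A) →
                filter P? (filter Q? xs) ≡ filter Q? (filter P? xs)
  filter-comm Q? []       = refl
  filter-comm Q? (x ∷ xs) with does (P? x) in p | does (Q? x) in q
  ... | true  | true  rewrite p | q = cong (x ∷_) (filter-comm Q? xs)
  ... | true  | false rewrite q     = filter-comm Q? xs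
  ... | false | true  rewrite p     = filter-comm Q? xs
  ... | false | false               = filter-comm Q? xs

module _ {A B : Set} {R : A → B → Set} (R? : ∀ x y → Dec (R x y)) where

  sum-length-filter-comm : ∀ xs ys → sum (map (λ x → length (filter (R? x) ys)) xs) ≡
                                     sum (map (λ y → length (filter (λ x → R? x y) xs)) ys)
  sum-length-filter-comm xs []       = trans (sum-map-const 0 xs) (*-zeroʳ (length xs))
  sum-length-filter-comm xs (y ∷ ys) = begin
    sum (map (λ x → length (filter (R? x) (y ∷ ys))) xs)
      ≡⟨ cong sum (map-cong (λ x → length-filter-∷ (R? x) y ys) xs) ⟩
    sum (map (λ x → indicator (R? x) y + length (filter (R? x) ys)) xs)
      ≡⟨ sum-map-+ (λ x → indicator (R? x) y) _ xs ⟩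
    sum (map (λ x → indicator (R? x) y) xs) + sum (map (λ x → length (filter (R? x) ys)) xs)
      ≡⟨ cong₂ _+_ (sum-map-indicator (λ x → R? x y) xs) (sum-length-filter-comm xs ys) ⟩
    length (filter (λ x → R? x y) xs) + sum (map (λ y → length (filter (λ x → R? x y) xs)) ys) ∎
    where open ≡-Reasoning

prod : {A : Set} → List A → List (List A) → List (List A)
prod xs yss = concatMap (λ x → map (x ∷_) yss) xs

module _ {A : Set} where

  ∈-prod⁺ : ∀ {x : A} {ys xs yss} → x ∈ xs → ys ∈ yss → x ∷ ys ∈ prod xs yss
  ∈-prod⁺ {x} {yss = yss} x∈xs ys∈yss =
    ∈-concatMap⁺ (λ z → map (z ∷_) yss) (Any.map (λ { refl → ∈-map⁺ (x ∷_) ys∈yss }) x∈xs)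

  ∈-prod⁻ : ∀ {zs : List A} xs yss → zs ∈ prod xs yss →
            ∃₂ λ x ys → x ∈ xs × ys ∈ yss × zs ≡ x ∷ ys
  ∈-prod⁻ xs yss zs∈ with find (∈-concatMap⁻ (λ x → map (x ∷_) yss) {xs = xs} zs∈)
  ... | x , x∈xs , zs∈x∷yss with map∷⁻ zs∈x∷yss
  ... | ys , ys∈yss , refl = x , ys , x∈xs , ys∈yss , refl

  filter-all?-prod : {P : A → Set} (P? : Decidable P) (xs : List A) (yss : List (List A)) →
                    filter (all? P?) (prod xs yss) ≡ prod (filter P? xs) (filter (all? P?) yss)
  filter-all?-prod P? []       yss = refl
  filter-all?-prod P? (x ∷ xs) yss with P? x
  ... | yes px = begin
    filter (all? P?) (map (x ∷_) yss ++ prod xs yss)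
      ≡⟨ filter-++ (all? P?) (map (x ∷_) yss) _ ⟩
    filter (all? P?) (map (x ∷_) yss) ++ filter (all? P?) (prod xs yss)
      ≡⟨ cong₂ _++_ (filter-map (all? P?) (x ∷_) yss) (filter-all?-prod P? xs yss) ⟩
    map (x ∷_) (filter (all? P? ∘ (x ∷_)) yss) ++ prod (filter P? xs) (filter (all? P?) yss)
      ≡⟨ cong (λ zss → map (x ∷_) zss ++ _) (filter-≐ (all? P? ∘ (x ∷_)) (all? P?)
                                               (All.tail , (px ∷_)) yss) ⟩
    map (x ∷_) (filter (all? P?) yss) ++ prod (filter P? xs) (filter (all? P?) yss) ∎
    where open ≡-Reasoning
  ... | no ¬px = begin
    filter (all? P?) (map (x ∷_) yss ++ prod xs yss)
      ≡⟨ filter-++ (all? P?) (map (x ∷_) yss) _ ⟩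
    filter (all? P?) (map (x ∷_) yss) ++ filter (all? P?) (prod xs yss)
      ≡⟨ cong₂ _++_
                    (filter-none (all? P?) (All.map⁺ {xs = yss} (All.tabulate (λ _ → ¬px ∘ All.head))))
                    (filter-all?-prod P? xs yss) ⟩
    prod (filter P? xs) (filter (all? P?) yss) ∎
    where open ≡-Reasoning

  prod-map : {B : Set} (f : A → B) (xs : List A) (yss : List (List A)) →
             prod (map f xs) (map (map f) yss) ≡ map (map f) (prod xs yss)
  prod-map f []       yss = refl
  prod-map f (x ∷ xs) yss = begin
    map (f x ∷_) (map (map f) yss) ++ prod (map f xs) (map (map f) yss)
      ≡⟨ cong₂ _++_ (sym (map-∘ yss)) (prod-map f xs yss) ⟩
    map (map f ∘ (x ∷_)) yss ++ map (map f) (prod xs yss)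
      ≡⟨ cong (_++ map (map f) (prod xs yss)) (map-∘ yss) ⟩
    map (map f) (map (x ∷_) yss) ++ map (map f) (prod xs yss)
      ≡⟨ map-++ (map f) (map (x ∷_) yss) _ ⟨
    map (map f) (map (x ∷_) yss ++ prod xs yss) ∎
    where open ≡-Reasoning

Tableau : Set
Tableau = List (List ℕ)

oneTo : ℕ → List ℕ
oneTo m = map suc (upTo m)

oneTo-suc : ∀ m → oneTo (suc m) ≡ 1 ∷ map suc (oneTo m)
oneTo-suc m = cong (λ xs → 1 ∷ map suc xs) (sym (map-upTo suc m))

length-oneTo : ∀ m → length (oneTo m) ≡ m
length-oneTo m = trans (length-map suc (upTo m)) (length-upTo m)

∈-oneTo⁻ : ∀ {x m} → x ∈ oneTo m → 1 ≤ x × x ≤ m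
∈-oneTo⁻ x∈ with ∈-map⁻ suc x∈
... | _ , i∈ , refl = s≤s z≤n , ∈-upTo⁻ i∈

suc-∈-oneTo : ∀ {x m} → x ∈ oneTo m → suc x ∈ oneTo (suc m)
suc-∈-oneTo {x} {m} x∈ = subst (suc x ∈_) (sym (oneTo-suc m)) (there (∈-map⁺ suc x∈))

punchIn : ℕ → ℕ → ℕ
punchIn zero    x       = suc x
punchIn (suc j) zero    = zero
punchIn (suc j) (suc x) = suc (punchIn j x)

punchIn-<ᵇ : ∀ j x y → (punchIn j x <ᵇ punchIn j y) ≡ (x <ᵇ y)
punchIn-<ᵇ zero    x       y       = refl
punchIn-<ᵇ (suc j) zero    zero    = refl
punchIn-<ᵇ (suc j) zero    (suc y) = refl
punchIn-<ᵇ (suc j) (suc x) zero    = refl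
punchIn-<ᵇ (suc j) (suc x) (suc y) = punchIn-<ᵇ j x y

<ᵇ-suc : ∀ x y → (x <ᵇ suc y) ≡ (x ≤ᵇ y)
<ᵇ-suc zero    y = refl
<ᵇ-suc (suc x) y = refl

punchIn-≤ᵇ : ∀ j x y → (punchIn j x ≤ᵇ punchIn j y) ≡ (x ≤ᵇ y)
punchIn-≤ᵇ zero    x       y       = <ᵇ-suc x y
punchIn-≤ᵇ (suc j) zero    y       = refl
punchIn-≤ᵇ (suc j) (suc x) zero    = refl
punchIn-≤ᵇ (suc j) (suc x) (suc y) =
  trans (<ᵇ-suc (punchIn j x) (punchIn j y)) (trans (punchIn-≤ᵇ j x y) (sym (<ᵇ-suc x y)))

module _ (f : ℕ → ℕ) (f-≤ᵇ : ∀ x y → (f x ≤ᵇ f y) ≡ (x ≤ᵇ y))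
                     (f-<ᵇ : ∀ x y → (f x <ᵇ f y) ≡ (x <ᵇ y)) where

  rowWeak-map : ∀ r → rowWeak (map f r) ≡ rowWeak r
  rowWeak-map []           = refl
  rowWeak-map (x ∷ [])     = refl
  rowWeak-map (x ∷ y ∷ r) = cong₂ _∧_ (f-≤ᵇ x y) (rowWeak-map (y ∷ r))

  allᵇ-zip-map : ∀ {Q : ℕ × ℕ → Bool} → (∀ x y → Q (f x , f y) ≡ Q (x , y)) →
                 ∀ r s → allᵇ Q (zip (map f r) (map f s)) ≡ allᵇ Q (zip r s)
  allᵇ-zip-map Q-f []      s       = refl
  allᵇ-zip-map Q-f (x ∷ r) []      = refl
  allᵇ-zip-map Q-f (x ∷ r) (y ∷ s) = cong₂ _∧_ (Q-f x y) (allᵇ-zip-map Q-f r s)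

  colStrict-map : ∀ t → colStrict (map (map f) t) ≡ colStrict t
  colStrict-map []              = refl
  colStrict-map (r ∷ [])        = refl
  colStrict-map (r ∷ s ∷ rows) = cong₂ _∧_ (allᵇ-zip-map f-<ᵇ r s) (colStrict-map (s ∷ rows))

  allᵇ-rowWeak-map : ∀ t → allᵇ rowWeak (map (map f) t) ≡ allᵇ rowWeak t
  allᵇ-rowWeak-map []      = refl
  allᵇ-rowWeak-map (r ∷ t) = cong₂ _∧_ (rowWeak-map r) (allᵇ-rowWeak-map t)

  isSSYT-map : ∀ t → isSSYT (map (map f) t) ≡ isSSYT t
  isSSYT-map t = cong₂ _∧_ (allᵇ-rowWeak-map t) (colStrict-map t)

Avoids : ℕ → Tableau → Set
Avoids j = All (All (j ≢_))

infix 4 _≢?_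
_≢?_ : ∀ (j x : ℕ) → Dec (j ≢ x)
j ≢? x = ¬? (j ≟ x)

avoids? : ∀ j → Decidable (Avoids j)
avoids? j = all? (all? (j ≢?_))

occurs⇒¬Avoids : ∀ {j t} → Any (j ∈_) t → ¬ Avoids j t
occurs⇒¬Avoids j∈t avoids = All¬⇒¬Any (All.map All¬⇒¬Any avoids) j∈t

ssyt? : Decidable (λ t → isSSYT t ≡ true)
ssyt? t = isSSYT t Bool.≟ true

SSYTs : ℕ → List ℕ → List Tableau
SSYTs m sh = filter ssyt? (fillings m sh)

filter-≢-oneTo : ∀ {j m} → 1 ≤ j → j ≤ suc m →
                 filter (j ≢?_) (oneTo (suc m)) ≡ map (punchIn j) (oneTo m)
filter-≢-oneTo {suc zero} {m} _ _ = begin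
  filter (1 ≢?_) (oneTo (suc m))
    ≡⟨ cong (filter (1 ≢?_)) (oneTo-suc m) ⟩
  filter (1 ≢?_) (map suc (oneTo m))
    ≡⟨ filter-all (1 ≢?_) (All.map⁺ (All.tabulate (1+x≢1 ∘ proj₁ ∘ ∈-oneTo⁻))) ⟩
  map suc (oneTo m)
    ≡⟨ map-cong-local (All.tabulate (punchIn-1 ∘ proj₁ ∘ ∈-oneTo⁻)) ⟩
  map (punchIn 1) (oneTo m) ∎
  where
  open ≡-Reasoning
  1+x≢1 : ∀ {x} → 1 ≤ x → 1 ≢ suc x
  1+x≢1 (s≤s _) ()
  punchIn-1 : ∀ {x} → 1 ≤ x → suc x ≡ punchIn 1 x
  punchIn-1 (s≤s _) = refl
filter-≢-oneTo {suc (suc j)} {suc m} _ (s≤s j<1+m) = begin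
  filter (2 + j ≢?_) (oneTo (2 + m))
    ≡⟨ cong (filter (2 + j ≢?_)) (oneTo-suc (suc m)) ⟩
  1 ∷ filter (2 + j ≢?_) (map suc (oneTo (suc m)))
    ≡⟨ cong (1 ∷_) (filter-map (2 + j ≢?_) suc (oneTo (suc m))) ⟩
  1 ∷ map suc (filter ((2 + j ≢?_) ∘ suc) (oneTo (suc m)))
    ≡⟨ cong (λ xs → 1 ∷ map suc xs)
            (filter-≐ ((2 + j ≢?_) ∘ suc) (1 + j ≢?_) ((_∘ cong suc) , (_∘ suc-injective)) (oneTo (suc m))) ⟩
  1 ∷ map suc (filter (1 + j ≢?_) (oneTo (suc m)))
    ≡⟨ cong (λ xs → 1 ∷ map suc xs) (filter-≢-oneTo (s≤s z≤n) j<1+m) ⟩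
  1 ∷ map suc (map (punchIn (1 + j)) (oneTo m))
    ≡⟨ cong (1 ∷_) (trans (sym (map-∘ (oneTo m))) (map-∘ (oneTo m))) ⟩
  1 ∷ map (punchIn (2 + j)) (map suc (oneTo m))
    ≡⟨ cong (map (punchIn (2 + j))) (oneTo-suc m) ⟨
  map (punchIn (2 + j)) (oneTo (suc m)) ∎
  where open ≡-Reasoning

module _ {j m : ℕ} (1≤j : 1 ≤ j) (j≤1+m : j ≤ suc m) where

  words-avoiding : ∀ r → filter (all? (j ≢?_)) (words (suc m) r) ≡
                         map (map (punchIn j)) (words m r)
  words-avoiding zero    = refl
  words-avoiding (suc r) = begin
    filter (all? (j ≢?_)) (prod (oneTo (suc m)) (words (suc m) r))
      ≡⟨ filter-all?-prod (j ≢?_) (oneTo (suc m)) (words (suc m) r) ⟩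
    prod (filter (j ≢?_) (oneTo (suc m))) (filter (all? (j ≢?_)) (words (suc m) r))
      ≡⟨ cong₂ prod (filter-≢-oneTo 1≤j j≤1+m) (words-avoiding r) ⟩
    prod (map (punchIn j) (oneTo m)) (map (map (punchIn j)) (words m r))
      ≡⟨ prod-map (punchIn j) (oneTo m) (words m r) ⟩
    map (map (punchIn j)) (words m (suc r)) ∎
    where open ≡-Reasoning

  fillings-avoiding : ∀ sh → filter (avoids? j) (fillings (suc m) sh) ≡
                             map (map (map (punchIn j))) (fillings m sh)
  fillings-avoiding []       = refl
  fillings-avoiding (r ∷ sh) = begin
    filter (avoids? j) (prod (words (suc m) r) (fillings (suc m) sh))
      ≡⟨ filter-all?-prod (all? (j ≢?_)) (words (suc m) r) (fillings (suc m) sh) ⟩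
    prod (filter (all? (j ≢?_)) (words (suc m) r)) (filter (avoids? j) (fillings (suc m) sh))
      ≡⟨ cong₂ prod (words-avoiding r) (fillings-avoiding sh) ⟩
    prod (map (map (punchIn j)) (words m r)) (map (map (map (punchIn j))) (fillings m sh))
      ≡⟨ prod-map (map (punchIn j)) (words m r) (fillings m sh) ⟩
    map (map (map (punchIn j))) (fillings m (r ∷ sh)) ∎
    where open ≡-Reasoning

  SSYTs-avoiding : ∀ sh → filter (avoids? j) (SSYTs (suc m) sh) ≡
                          map (map (map (punchIn j))) (SSYTs m sh)
  SSYTs-avoiding sh = begin
    filter (avoids? j) (filter ssyt? (fillings (suc m) sh))
      ≡⟨ filter-comm (avoids? j) ssyt? (fillings (suc m) sh) ⟩
    filter ssyt? (filter (avoids? j) (fillings (suc m) sh))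
      ≡⟨ cong (filter ssyt?) (fillings-avoiding sh) ⟩
    filter ssyt? (map relabel (fillings m sh))
      ≡⟨ filter-map ssyt? relabel (fillings m sh) ⟩
    map relabel (filter (ssyt? ∘ relabel) (fillings m sh))
      ≡⟨ cong (map relabel) (filter-≐ (ssyt? ∘ relabel) ssyt?
           ((λ {t} → trans (sym (isSSYT-relabel t))) , (λ {t} → trans (isSSYT-relabel t)))
           (fillings m sh)) ⟩
    map relabel (SSYTs m sh) ∎
    where
    open ≡-Reasoning
    relabel : Tableau → Tableau
    relabel = map (map (punchIn j))
    isSSYT-relabel : ∀ t → isSSYT (relabel t) ≡ isSSYT t
    isSSYT-relabel = isSSYT-map (punchIn j) (punchIn-≤ᵇ j) (punchIn-<ᵇ j)

∈-words⁺ : ∀ {m w} → All (_∈ oneTo m) w → w ∈ words m (length w)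
∈-words⁺ []          = here refl
∈-words⁺ (x∈ ∷ w∈) = ∈-prod⁺ x∈ (∈-words⁺ w∈)

∈-fillings⁺ : ∀ {m t} → All (All (_∈ oneTo m)) t → t ∈ fillings m (map length t)
∈-fillings⁺ []          = here refl
∈-fillings⁺ (w∈ ∷ t∈) = ∈-prod⁺ (∈-words⁺ w∈) (∈-fillings⁺ t∈)

∈-SSYTs⁺ : ∀ {m sh t} → map length t ≡ sh → All (All (_∈ oneTo m)) t → isSSYT t ≡ true →
           t ∈ SSYTs m sh
∈-SSYTs⁺ refl t∈ t-ssyt = ∈-filter⁺ ssyt? (∈-fillings⁺ t∈) t-ssyt

distinctValues absentValues : ℕ → Tableau → ℕ
distinctValues k t = length (filter (λ j → ¬? (avoids? j t)) (oneTo k))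
absentValues   k t = length (filter (λ j → avoids? j t) (oneTo k))

excess : ℕ → Tableau → ℕ
excess k t = distinctValues k t ∸ 1

Σexcess : ℕ → List ℕ → ℕ
Σexcess k sh = sum (map (excess k) (SSYTs k sh))

absentValues+distinctValues≡k : ∀ k t → absentValues k t + distinctValues k t ≡ k
absentValues+distinctValues≡k k t =
  trans (length-filter-∁ (λ j → avoids? j t) (oneTo k)) (length-oneTo k)

length≤distinctValues : ∀ {k t vs} → Unique vs → All (_∈ oneTo k) vs →
                        All (λ v → Any (v ∈_) t) vs → length vs ≤ distinctValues k t
length≤distinctValues {t = t} vs-unique vs-bounded vs-occur = length-mono-⊆ vs-unique
  (λ v∈vs → ∈-filter⁺ (λ j → ¬? (avoids? j t)) (All.lookup vs-bounded v∈vs)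
                       (occurs⇒¬Avoids (All.lookup vs-occur v∈vs)))

1≤distinctValues : ∀ {k p sh t} → t ∈ SSYTs k (suc p ∷ sh) → 1 ≤ distinctValues k t
1≤distinctValues {k} {p} {sh} t∈
  with ∈-prod⁻ (words k (suc p)) (fillings k sh) (proj₁ (∈-filter⁻ ssyt? t∈))
... | w , rows , w∈ , _ , refl with ∈-prod⁻ (oneTo k) (words k p) w∈
... | x , r , x∈ , _ , refl = length≤distinctValues ([] ∷ []) (x∈ ∷ []) (here (here refl) ∷ [])

sum-absentValues : ∀ m sh → sum (map (absentValues (suc m)) (SSYTs (suc m) sh)) ≡
                            suc m * length (SSYTs m sh)
sum-absentValues m sh = begin
  sum (map (absentValues (suc m)) (SSYTs (suc m) sh))
    ≡⟨ sum-length-filter-comm (λ t j → avoids? j t) (SSYTs (suc m) sh) (oneTo (suc m)) ⟩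
  sum (map (λ j → length (filter (avoids? j) (SSYTs (suc m) sh))) (oneTo (suc m)))
    ≡⟨ cong sum (map-cong-local (All.tabulate count-avoiding)) ⟩
  sum (map (λ _ → length (SSYTs m sh)) (oneTo (suc m)))
    ≡⟨ sum-map-const (length (SSYTs m sh)) (oneTo (suc m)) ⟩
  length (oneTo (suc m)) * length (SSYTs m sh)
    ≡⟨ cong (_* length (SSYTs m sh)) (length-oneTo (suc m)) ⟩
  suc m * length (SSYTs m sh) ∎
  where
  open ≡-Reasoning
  count-avoiding : ∀ {j} → j ∈ oneTo (suc m) →
                   length (filter (avoids? j) (SSYTs (suc m) sh)) ≡ length (SSYTs m sh)
  count-avoiding j∈ with ∈-oneTo⁻ j∈
  ... | 1≤j , j≤1+m = trans (cong length (SSYTs-avoiding 1≤j j≤1+m sh)) (length-map _ (SSYTs m sh))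

sum-distinctValues : ∀ k p sh → sum (map (distinctValues k) (SSYTs k (suc p ∷ sh))) ≡
                                length (SSYTs k (suc p ∷ sh)) + Σexcess k (suc p ∷ sh)
sum-distinctValues k p sh = begin
  sum (map (distinctValues k) SS)
    ≡⟨ cong sum (map-cong-local {f = distinctValues k} {xs = SS}
         (All.tabulate (λ t∈ → sym (m+[n∸m]≡n (1≤distinctValues {k} {p} {sh} t∈))))) ⟩
  sum (map (λ t → 1 + excess k t) SS)
    ≡⟨ sum-map-+ (λ _ → 1) (excess k) SS ⟩
  sum (map (λ _ → 1) SS) + Σexcess k (suc p ∷ sh)
    ≡⟨ cong (_+ Σexcess k (suc p ∷ sh)) (trans (sum-map-const 1 SS) (*-identityʳ (length SS))) ⟩
  length SS + Σexcess k (suc p ∷ sh) ∎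
  where
  open ≡-Reasoning
  SS = SSYTs k (suc p ∷ sh)

double-count : ∀ m p sh →
  suc m * length (SSYTs m (suc p ∷ sh)) + Σexcess (suc m) (suc p ∷ sh) ≡
  m * length (SSYTs (suc m) (suc p ∷ sh))
double-count m p sh = sym (+-cancelˡ-≡ N _ _ (begin
  suc m * N
    ≡⟨ *-comm (suc m) N ⟩
  N * suc m
    ≡⟨ sum-map-const (suc m) SS ⟨
  sum (map (λ _ → suc m) SS)
    ≡⟨ cong sum (map-cong (absentValues+distinctValues≡k (suc m)) SS) ⟨
  sum (map (λ t → absentValues (suc m) t + distinctValues (suc m) t) SS)
    ≡⟨ sum-map-+ (absentValues (suc m)) (distinctValues (suc m)) SS ⟩
  sum (map (absentValues (suc m)) SS) + sum (map (distinctValues (suc m)) SS)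
    ≡⟨ cong₂ _+_ (sum-absentValues m (suc p ∷ sh)) (sum-distinctValues (suc m) p sh) ⟩
  suc m * s + (N + E)
    ≡⟨ x∙yz≈y∙xz +-commutativeSemigroup (suc m * s) N E ⟩
  N + (suc m * s + E) ∎))
  where
  open ≡-Reasoning
  SS = SSYTs (suc m) (suc p ∷ sh)
  N  = length SS
  s  = length (SSYTs m (suc p ∷ sh))
  E  = Σexcess (suc m) (suc p ∷ sh)

[2+n]*[1+n]≡2*[1+n]+[1+n]*n : ∀ n → suc (suc n) * suc n ≡ 2 * suc n + suc n * n
[2+n]*[1+n]≡2*[1+n]+[1+n]*n n =
  trans (*-distribʳ-+ (suc n) 2 n) (cong (2 * suc n +_) (*-comm n (suc n)))

2*[1+n]C2≡[1+n]*n : ∀ n → 2 * (suc n C 2) ≡ suc n * n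
2*[1+n]C2≡[1+n]*n zero    = refl
2*[1+n]C2≡[1+n]*n (suc n) = begin
  2 * (suc (suc n) C 2)
    ≡⟨ cong (2 *_) (nCk+nC[k+1]≡[n+1]C[k+1] (suc n) 1) ⟨
  2 * (suc n C 1 + suc n C 2)
    ≡⟨ *-distribˡ-+ 2 (suc n C 1) (suc n C 2) ⟩
  2 * (suc n C 1) + 2 * (suc n C 2)
    ≡⟨ cong₂ (λ a b → 2 * a + b) (nC1≡n (suc n)) (2*[1+n]C2≡[1+n]*n n) ⟩
  2 * suc n + suc n * n
    ≡⟨ [2+n]*[1+n]≡2*[1+n]+[1+n]*n n ⟨
  suc (suc n) * suc n ∎
  where open ≡-Reasoning

1≤nCk : ∀ {n k} → k ≤ n → 1 ≤ n C k
1≤nCk {n}     {zero}  _         = ≤-refl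
1≤nCk {suc n} {suc k} (s≤s k≤n) = begin
  1                      ≤⟨ 1≤nCk k≤n ⟩
  n C k                  ≤⟨ m≤m+n (n C k) (n C suc k) ⟩
  n C k + n C suc k      ≡⟨ nCk+nC[k+1]≡[n+1]C[k+1] n k ⟩
  suc n C suc k          ∎
  where open ≤-Reasoning

n≤nCk : ∀ {n k} → 1 ≤ k → k < n → n ≤ n C k
n≤nCk {n}     {suc zero}    _ _                 = ≤-reflexive (sym (nC1≡n n))
n≤nCk {suc n} {suc (suc k)} _ (s≤s 2+k≤n) = begin
  suc n                        ≡⟨ +-comm 1 n ⟩
  n + 1                        ≤⟨ +-mono-≤ (n≤nCk (s≤s z≤n) 2+k≤n) (1≤nCk 2+k≤n) ⟩
  n C suc k + n C suc (suc k)  ≡⟨ nCk+nC[k+1]≡[n+1]C[k+1] n (suc k) ⟩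
  suc n C suc (suc k)          ∎
  where open ≤-Reasoning

n*[n∸1]≤nCℓ*[ℓ∸1] : ∀ {ℓ n} → 3 ≤ ℓ → ℓ + 2 ≤ n → n * (n ∸ 1) ≤ (n C ℓ) * (ℓ ∸ 1)
n*[n∸1]≤nCℓ*[ℓ∸1] {suc ℓ} (s≤s 2≤ℓ) ℓ+3≤n = go (≤⇒≤′ ℓ+3≤n)
  where
  open ≤-Reasoning
  go : ∀ {n} → suc ℓ + 2 ≤′ n → n * (n ∸ 1) ≤ (n C suc ℓ) * ℓ
  go ≤′-refl = begin
    suc (ℓ + 2) * (ℓ + 2)            ≡⟨ 2*[1+n]C2≡[1+n]*n (ℓ + 2) ⟨
    2 * (suc (ℓ + 2) C 2)            ≡⟨ *-comm 2 (suc (ℓ + 2) C 2) ⟩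
    (suc (ℓ + 2) C 2) * 2            ≤⟨ *-monoʳ-≤ (suc (ℓ + 2) C 2) 2≤ℓ ⟩
    (suc (ℓ + 2) C 2) * ℓ            ≡⟨ cong (λ i → (suc (ℓ + 2) C i) * ℓ) (m+n∸m≡n ℓ 2) ⟨
    (suc (ℓ + 2) C (ℓ + 2 ∸ ℓ)) * ℓ  ≡⟨ cong (_* ℓ) (nCk≡nC[n∸k] (s≤s (m≤m+n ℓ 2))) ⟨
    (suc (ℓ + 2) C suc ℓ) * ℓ        ∎
  go {suc zero}    (≤′-step (≤′-reflexive ()))
  go {suc (suc n)} (≤′-step ℓ+3≤′1+n) = begin
    suc (suc n) * suc n                    ≡⟨ [2+n]*[1+n]≡2*[1+n]+[1+n]*n n ⟩
    2 * suc n + suc n * n                  ≤⟨ +-mono-≤ 2*[1+n]≤[1+n]Cℓ*ℓ (go ℓ+3≤′1+n) ⟩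
    (suc n C ℓ) * ℓ + (suc n C suc ℓ) * ℓ  ≡⟨ *-distribʳ-+ ℓ (suc n C ℓ) _ ⟨
    (suc n C ℓ + suc n C suc ℓ) * ℓ        ≡⟨ cong (_* ℓ) (nCk+nC[k+1]≡[n+1]C[k+1] (suc n) ℓ) ⟩
    (suc (suc n) C suc ℓ) * ℓ              ∎
    where
    2*[1+n]≤[1+n]Cℓ*ℓ : 2 * suc n ≤ (suc n C ℓ) * ℓ
    2*[1+n]≤[1+n]Cℓ*ℓ = begin
      2 * suc n          ≡⟨ *-comm 2 (suc n) ⟩
      suc n * 2          ≤⟨ *-mono-≤ (n≤nCk (≤-trans (s≤s z≤n) 2≤ℓ) ℓ<1+n) 2≤ℓ ⟩
      (suc n C ℓ) * ℓ    ∎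
      where
      ℓ<1+n : ℓ < suc n
      ℓ<1+n = ≤-trans (m≤m+n (suc ℓ) 2) (≤′⇒≤ ℓ+3≤′1+n)

nC2≤2*nC3 : ∀ {n} → 4 ≤ n → n C 2 ≤ 2 * (n C 3)
nC2≤2*nC3 4≤n = go (≤⇒≤′ 4≤n)
  where
  open ≤-Reasoning
  go : ∀ {n} → 4 ≤′ n → n C 2 ≤ 2 * (n C 3)
  go ≤′-refl                 = ≤ᵇ⇒≤ 6 8 _
  go {suc n} (≤′-step 4≤′n) = begin
    suc n C 2                  ≡⟨ nCk+nC[k+1]≡[n+1]C[k+1] n 1 ⟨
    n C 1 + n C 2              ≤⟨ +-mono-≤ nC1≤nC2 (go 4≤′n) ⟩
    n C 2 + 2 * (n C 3)        ≤⟨ +-monoˡ-≤ (2 * (n C 3)) (m≤m+n (n C 2) (n C 2 + 0)) ⟩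
    2 * (n C 2) + 2 * (n C 3)  ≡⟨ *-distribˡ-+ 2 (n C 2) (n C 3) ⟨
    2 * (n C 2 + n C 3)        ≡⟨ cong (2 *_) (nCk+nC[k+1]≡[n+1]C[k+1] n 2) ⟩
    2 * (suc n C 3)            ∎
    where
    nC1≤nC2 : n C 1 ≤ n C 2
    nC1≤nC2 = subst (_≤ n C 2) (sym (nC1≡n n))
              (n≤nCk (s≤s z≤n) (≤-trans (n≤1+n 3) (≤′⇒≤ 4≤′n)))

n*[n∸1]≤nC2+nC3*2 : ∀ {n} → 4 ≤ n → n * (n ∸ 1) ≤ (n C 2) * 1 + (n C 3) * 2
n*[n∸1]≤nC2+nC3*2 {suc n} 4≤n = begin
  suc n * n                     ≡⟨ 2*[1+n]C2≡[1+n]*n n ⟨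
  suc n C 2 + (suc n C 2 + 0)   ≡⟨ cong (suc n C 2 +_) (+-identityʳ (suc n C 2)) ⟩
  suc n C 2 + suc n C 2         ≤⟨ +-monoʳ-≤ (suc n C 2) (nC2≤2*nC3 4≤n) ⟩
  suc n C 2 + 2 * (suc n C 3)   ≡⟨ cong₂ _+_ (*-identityʳ (suc n C 2)) (*-comm (suc n C 3) 2) ⟨
  (suc n C 2) * 1 + (suc n C 3) * 2 ∎
  where open ≤-Reasoning

Increasing : ℕ → ℕ → List ℕ → Set
Increasing k n c = length c ≡ n × All (_∈ oneTo k) c × Linked _<_ c

Increasing⇒Unique : ∀ {k n c} → Increasing k n c → Unique c
Increasing⇒Unique (_ , _ , c-inc) = AllPairs.map <⇒≢ (Linked⇒AllPairs <-trans c-inc)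

Increasing-map-suc : ∀ {k n c} → Increasing k n c → Increasing (suc k) n (map suc c)
Increasing-map-suc {c = c} (c-len , c-bnd , c-inc) =
    trans (length-map suc c) c-len
  , All.map⁺ (All.map suc-∈-oneTo c-bnd)
  , Linked.map⁺ (Linked.map s<s c-inc)

Increasing-1∷ : ∀ {k n c} → Increasing k n c → Increasing (suc k) (suc n) (1 ∷ map suc c)
Increasing-1∷ {c = c} c-incr@(_ , c-bnd , _) with Increasing-map-suc c-incr
... | c-len , sc-bnd , sc-inc = cong suc c-len , here refl ∷ sc-bnd , cons c-bnd sc-inc
  where
  cons : ∀ {d} → All (_∈ oneTo _) d → Linked _<_ (map suc d) → Linked _<_ (1 ∷ map suc d)
  cons []           _   = [-]
  cons (x∈ ∷ _) inc = s≤s (proj₁ (∈-oneTo⁻ x∈)) ∷ inc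

choose : ℕ → ℕ → List (List ℕ)
choose k       zero    = [] ∷ []
choose zero    (suc n) = []
choose (suc k) (suc n) = map (λ c → 1 ∷ map suc c) (choose k n) ++ map (map suc) (choose k (suc n))

length-choose : ∀ k n → length (choose k n) ≡ k C n
length-choose k       zero    = refl
length-choose zero    (suc n) = refl
length-choose (suc k) (suc n) = begin
  length (map (λ c → 1 ∷ map suc c) (choose k n) ++ map (map suc) (choose k (suc n)))
    ≡⟨ length-++ (map (λ c → 1 ∷ map suc c) (choose k n)) ⟩
  length (map (λ c → 1 ∷ map suc c) (choose k n)) + length (map (map suc) (choose k (suc n)))
    ≡⟨ cong₂ _+_ (length-map _ (choose k n)) (length-map _ (choose k (suc n))) ⟩
  length (choose k n) + length (choose k (suc n))
    ≡⟨ cong₂ _+_ (length-choose k n) (length-choose k (suc n)) ⟩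
  k C n + k C suc n
    ≡⟨ nCk+nC[k+1]≡[n+1]C[k+1] k n ⟩
  suc k C suc n ∎
  where open ≡-Reasoning

choose⇒Increasing : ∀ k n {c} → c ∈ choose k n → Increasing k n c
choose⇒Increasing k       zero    (here refl) = refl , [] , []
choose⇒Increasing (suc k) (suc n) c∈ with ∈-++⁻ (map (λ c → 1 ∷ map suc c) (choose k n)) c∈
... | inj₁ c∈₁ with ∈-map⁻ (λ c → 1 ∷ map suc c) c∈₁
...   | d , d∈ , refl = Increasing-1∷ (choose⇒Increasing k n d∈)
choose⇒Increasing (suc k) (suc n) c∈ | inj₂ c∈₂ with ∈-map⁻ (map suc) c∈₂
...   | d , d∈ , refl = Increasing-map-suc (choose⇒Increasing k (suc n) d∈)

choose-unique : ∀ k n → Unique (choose k n)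
choose-unique k       zero    = [] ∷ []
choose-unique zero    (suc n) = []
choose-unique (suc k) (suc n) = Unique.++⁺
  (Unique.map⁺ (map-injective suc-injective ∘ ∷-injectiveʳ) (choose-unique k n))
  (Unique.map⁺ (map-injective suc-injective) (choose-unique k (suc n)))
  disjoint
  where
  disjoint : Disjoint (map (λ c → 1 ∷ map suc c) (choose k n)) (map (map suc) (choose k (suc n)))
  disjoint (c∈₁ , c∈₂) with ∈-map⁻ (λ c → 1 ∷ map suc c) c∈₁ | ∈-map⁻ (map suc) c∈₂
  ... | _ , _ , refl | x ∷ d , d∈ , 1≡1+x
    with choose⇒Increasing k (suc n) d∈
  ...   | _ , x∈ ∷ _ , _ with ∈-oneTo⁻ x∈
  ...     | 1≤x , _ = >⇒≢ 1≤x (sym (suc-injective (∷-injectiveˡ 1≡1+x)))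

Separated : List ℕ → List ℕ → Set
Separated r s = All (λ a → All (a <_) s) r

allᵇ-All : ∀ {A : Set} {p : A → Bool} {xs} → All (λ x → p x ≡ true) xs → allᵇ p xs ≡ true
allᵇ-All []         = refl
allᵇ-All (px ∷ pxs) = cong₂ _∧_ px (allᵇ-All pxs)

rowWeak-linked : ∀ {r} → Linked _≤_ r → rowWeak r ≡ true
rowWeak-linked []          = refl
rowWeak-linked [-]         = refl
rowWeak-linked (x≤y ∷ r≤) = cong₂ _∧_ (Equivalence.to T-≡ (≤⇒≤ᵇ x≤y)) (rowWeak-linked r≤)

allᵇ-zip-separated : ∀ {Q : ℕ × ℕ → Bool} → (∀ {a b} → a < b → Q (a , b) ≡ true) →
                     ∀ {r s} → Separated r s → allᵇ Q (zip r s) ≡ true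
allᵇ-zip-separated Q< {[]}            _              = refl
allᵇ-zip-separated Q< {x ∷ r} {[]}    _              = refl
allᵇ-zip-separated Q< {x ∷ r} {y ∷ s} (x<y∷s ∷ r<) =
  cong₂ _∧_ (Q< (All.head x<y∷s)) (allᵇ-zip-separated Q< (All.map All.tail r<))

colStrict-separated : ∀ {t} → Linked Separated t → colStrict t ≡ true
colStrict-separated []           = refl
colStrict-separated [-]          = refl
colStrict-separated (r<s ∷ t<) =
  cong₂ _∧_ (allᵇ-zip-separated (Equivalence.to T-≡ ∘ <⇒<ᵇ) r<s) (colStrict-separated t<)

isSSYT-intro : ∀ {t} → All (Linked _≤_) t → Linked Separated t → isSSYT t ≡ true
isSSYT-intro rows≤ cols< =
  cong₂ _∧_ (allᵇ-All (All.map rowWeak-linked rows≤)) (colStrict-separated cols<)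

Linked-replicate : ∀ n x → Linked _≤_ (replicate n x)
Linked-replicate zero          x = []
Linked-replicate (suc zero)    x = [-]
Linked-replicate (suc (suc n)) x = ≤-refl ∷ Linked-replicate (suc n) x

Linked-replicate-++ : ∀ {x y} → x ≤ y → ∀ a b → Linked _≤_ (replicate a x ++ replicate b y)
Linked-replicate-++ x≤y zero          b       = Linked-replicate b _
Linked-replicate-++ x≤y (suc zero)    zero    = [-]
Linked-replicate-++ x≤y (suc zero)    (suc b) = x≤y ∷ Linked-replicate (suc b) _
Linked-replicate-++ x≤y (suc (suc a)) b       = ≤-refl ∷ Linked-replicate-++ x≤y (suc a) b

replicate-++-injective : ∀ a b {x y x′ y′ : ℕ} →
  replicate (suc a) x ++ replicate (suc b) y ≡ replicate (suc a) x′ ++ replicate (suc b) y′ →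
  x ≡ x′ × y ≡ y′
replicate-++-injective zero    b eq = ∷-injectiveˡ eq , ∷-injectiveˡ (∷-injectiveʳ eq)
replicate-++-injective (suc a) b eq =
  ∷-injectiveˡ eq , proj₂ (replicate-++-injective a b (∷-injectiveʳ eq))

constantRows : List ℕ → List ℕ → Tableau
constantRows = zipWith replicate

All-constantRows : ∀ {P : ℕ → Set} {Q : List ℕ → Set} → (∀ {p x} → P x → Q (replicate p x)) →
                   ∀ sh {c} → All P c → All Q (constantRows sh c)
All-constantRows P⇒Q []       _          = []
All-constantRows P⇒Q (p ∷ sh) []         = []
All-constantRows P⇒Q (p ∷ sh) (px ∷ pc) = P⇒Q px ∷ All-constantRows P⇒Q sh pc

map-length-constantRows : ∀ sh {c} → length c ≡ length sh → map length (constantRows sh c) ≡ sh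
map-length-constantRows []       {[]}    _     = refl
map-length-constantRows (p ∷ sh) {x ∷ c} c-len =
  cong₂ _∷_ (length-replicate p) (map-length-constantRows sh (suc-injective c-len))

below-constantRows : ∀ {r} sh {c} → All (λ a → All (a <_) c) r → Linked _<_ c →
                     Linked Separated (r ∷ constantRows sh c)
below-constantRows []       _       _     = [-]
below-constantRows (p ∷ sh) {[]}    _     _     = [-]
below-constantRows (p ∷ sh) {x ∷ c} r<x∷c x∷c-inc with Linked⇒AllPairs <-trans x∷c-inc
... | x<c ∷ _ = All.map (λ a<x∷c → All.replicate⁺ p (All.head a<x∷c)) r<x∷c
              ∷ below-constantRows sh (All.replicate⁺ p x<c) (Linked.tail x∷c-inc)

constantRows-separated : ∀ sh {c} → Linked _<_ c → Linked Separated (constantRows sh c)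
constantRows-separated []       _         = []
constantRows-separated (p ∷ sh) {[]}    _ = []
constantRows-separated (p ∷ sh) {x ∷ c} x∷c-inc with Linked⇒AllPairs <-trans x∷c-inc
... | x<c ∷ _ = below-constantRows sh (All.replicate⁺ p x<c) (Linked.tail x∷c-inc)

constantRows-occurs : ∀ {sh c} → All (1 ≤_) sh → length c ≡ length sh →
                      All (λ v → Any (v ∈_) (constantRows sh c)) c
constantRows-occurs {[]}    {[]}    _                 _     = []
constantRows-occurs {_ ∷ _} {x ∷ c} (s≤s z≤n ∷ sh-pos) c-len =
  here (here refl) ∷ All.map there (constantRows-occurs sh-pos (suc-injective c-len))

constantRows-injective : ∀ {sh c d} → All (1 ≤_) sh → length c ≡ length sh → length d ≡ length sh →
                         constantRows sh c ≡ constantRows sh d → c ≡ d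
constantRows-injective {[]}    {[]}    {[]}    _                 _     _     _  = refl
constantRows-injective {_ ∷ _} {x ∷ c} {y ∷ d} (s≤s z≤n ∷ sh-pos) c-len d-len eq =
  cong₂ _∷_ (∷-injectiveˡ (∷-injectiveˡ eq))
            (constantRows-injective sh-pos (suc-injective c-len) (suc-injective d-len) (∷-injectiveʳ eq))

constantRows-∈-SSYTs : ∀ {k sh c} → Increasing k (length sh) c → constantRows sh c ∈ SSYTs k sh
constantRows-∈-SSYTs {sh = sh} (c-len , c-bnd , c-inc) = ∈-SSYTs⁺
  (map-length-constantRows sh c-len)
  (All-constantRows (All.replicate⁺ _) sh c-bnd)
  (isSSYT-intro (All-constantRows (λ _ → Linked-replicate _ _) sh c-bnd) (constantRows-separated sh c-inc))

splitFirstRow : ℕ → ℕ → List ℕ → List ℕ → Tableau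
splitFirstRow a b rest (x ∷ y ∷ c) = (replicate a x ++ replicate b y) ∷ constantRows rest c
splitFirstRow a b rest _           = []

module _ {k a b : ℕ} {rest : List ℕ} where

  splitFirstRow-injective : ∀ {c d} → All (1 ≤_) rest →
    Increasing k (2 + length rest) c → Increasing k (2 + length rest) d →
    splitFirstRow (suc a) (suc b) rest c ≡ splitFirstRow (suc a) (suc b) rest d → c ≡ d
  splitFirstRow-injective {x ∷ y ∷ c} {x′ ∷ y′ ∷ d} rest-pos (c-len , _) (d-len , _) eq
    with replicate-++-injective a b (∷-injectiveˡ eq)
  ... | refl , refl = cong (λ c → x ∷ y ∷ c) (constantRows-injective rest-pos
          (suc-injective (suc-injective c-len)) (suc-injective (suc-injective d-len)) (∷-injectiveʳ eq))
  splitFirstRow-injective {[]}        _ (() , _) _        _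
  splitFirstRow-injective {_ ∷ []}    _ (() , _) _        _
  splitFirstRow-injective {_ ∷ _ ∷ _} {[]}     _ _ (() , _) _
  splitFirstRow-injective {_ ∷ _ ∷ _} {_ ∷ []} _ _ (() , _) _

  splitFirstRow-∈-SSYTs : ∀ {λ₁ c} → suc a + suc b ≡ λ₁ → Increasing k (2 + length rest) c →
                          splitFirstRow (suc a) (suc b) rest c ∈ SSYTs k (λ₁ ∷ rest)
  splitFirstRow-∈-SSYTs {λ₁} {x ∷ y ∷ c} a+b≡λ₁ (c-len , x∈ ∷ y∈ ∷ c-bnd , x<y ∷ y∷c-inc)
    with Linked⇒AllPairs <-trans (x<y ∷ y∷c-inc)
  ... | (_ ∷ x<c) ∷ y<c ∷ _ = ∈-SSYTs⁺ shape entries (isSSYT-intro rows≤ cols<)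
    where
    row = replicate (suc a) x ++ replicate (suc b) y
    shape : map length (row ∷ constantRows rest c) ≡ λ₁ ∷ rest
    shape = cong₂ _∷_
      (trans (length-++ (replicate (suc a) x))
             (trans (cong₂ _+_ (length-replicate (suc a)) (length-replicate (suc b))) a+b≡λ₁))
      (map-length-constantRows rest (suc-injective (suc-injective c-len)))
    entries : All (All (_∈ oneTo k)) (row ∷ constantRows rest c)
    entries = All.++⁺ (All.replicate⁺ (suc a) x∈) (All.replicate⁺ (suc b) y∈)
            ∷ All-constantRows (All.replicate⁺ _) rest c-bnd
    rows≤ : All (Linked _≤_) (row ∷ constantRows rest c)
    rows≤ = Linked-replicate-++ (<⇒≤ x<y) (suc a) (suc b)
          ∷ All-constantRows (λ _ → Linked-replicate _ _) rest c-bnd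
    cols< : Linked Separated (row ∷ constantRows rest c)
    cols< = below-constantRows rest
              (All.++⁺ (All.replicate⁺ (suc a) x<c) (All.replicate⁺ (suc b) y<c)) (Linked.tail y∷c-inc)
  splitFirstRow-∈-SSYTs {c = []}     _ (() , _)
  splitFirstRow-∈-SSYTs {c = _ ∷ []} _ (() , _)

  splitFirstRow-occurs : ∀ {c} → All (1 ≤_) rest → Increasing k (2 + length rest) c →
                         All (λ v → Any (v ∈_) (splitFirstRow (suc a) (suc b) rest c)) c
  splitFirstRow-occurs {x ∷ y ∷ c} rest-pos (c-len , _) =
    here (∈-++⁺ˡ {xs = replicate (suc a) x} (here refl))
    ∷ here (∈-++⁺ʳ (replicate (suc a) x) (here refl))
    ∷ All.map there (constantRows-occurs rest-pos (suc-injective (suc-injective c-len)))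
  splitFirstRow-occurs {[]}     _ (() , _)
  splitFirstRow-occurs {_ ∷ []} _ (() , _)

record Embedding (k n : ℕ) (sh : List ℕ) : Set where
  field
    tableau      : List ℕ → Tableau
    injective    : ∀ {c d} → Increasing k n c → Increasing k n d → tableau c ≡ tableau d → c ≡ d
    semistandard : ∀ {c} → Increasing k n c → tableau c ∈ SSYTs k sh
    occurs       : ∀ {c} → Increasing k n c → All (λ v → Any (v ∈_) (tableau c)) c

  image : List Tableau
  image = map tableau (choose k n)

  image-unique : Unique image
  image-unique = Unique-map⁺ (All.tabulate (choose⇒Increasing k n)) injective (choose-unique k n)

  image⊆SSYTs : image ⊆ SSYTs k sh
  image⊆SSYTs t∈ with ∈-map⁻ tableau t∈
  ... | c , c∈ , refl = semistandard (choose⇒Increasing k n c∈)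

  sum-excess-image : (k C n) * (n ∸ 1) ≤ sum (map (excess k) image)
  sum-excess-image = subst (λ N → N * (n ∸ 1) ≤ sum (map (excess k) image))
    (trans (length-map tableau (choose k n)) (length-choose k n))
    (length*≤sum-map (excess k) n∸1≤excess)
    where
    n∸1≤excess : ∀ {t} → t ∈ image → n ∸ 1 ≤ excess k t
    n∸1≤excess t∈ with ∈-map⁻ tableau t∈
    ... | c , c∈ , refl with choose⇒Increasing k n c∈
    ... | c-incr@(c-len , c-bnd , _) = ∸-monoˡ-≤ 1 (subst (_≤ distinctValues k (tableau c)) c-len
            (length≤distinctValues (Increasing⇒Unique c-incr) c-bnd (occurs c-incr)))

open Embedding using (tableau; image; image-unique; image⊆SSYTs; sum-excess-image)

Σexcess≥embedding : ∀ {k n sh} → Embedding k n sh → (k C n) * (n ∸ 1) ≤ Σexcess k sh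
Σexcess≥embedding {k} E =
  ≤-trans (sum-excess-image E) (sum-map-mono-⊆ (excess k) (image-unique E) (image⊆SSYTs E))

Σexcess≥embeddings : ∀ {k n n′ sh} (E : Embedding k n sh) (F : Embedding k n′ sh) →
                     (∀ {c d} → Increasing k n c → Increasing k n′ d → tableau E c ≢ tableau F d) →
                     (k C n) * (n ∸ 1) + (k C n′) * (n′ ∸ 1) ≤ Σexcess k sh
Σexcess≥embeddings {k} {n} {n′} {sh} E F E≢F = begin
  (k C n) * (n ∸ 1) + (k C n′) * (n′ ∸ 1)
    ≤⟨ +-mono-≤ (sum-excess-image E) (sum-excess-image F) ⟩
  sum (map (excess k) (image E)) + sum (map (excess k) (image F))
    ≡⟨ sum-++ (map (excess k) (image E)) _ ⟨
  sum (map (excess k) (image E) ++ map (excess k) (image F))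
    ≡⟨ cong sum (map-++ (excess k) (image E) (image F)) ⟨
  sum (map (excess k) (image E ++ image F))
    ≤⟨ sum-map-mono-⊆ (excess k) (Unique.++⁺ (image-unique E) (image-unique F) disjoint)
                        ([ image⊆SSYTs E , image⊆SSYTs F ] ∘ ∈-++⁻ (image E)) ⟩
  Σexcess k sh ∎
  where
  open ≤-Reasoning
  disjoint : Disjoint (image E) (image F)
  disjoint (t∈E , t∈F) with ∈-map⁻ (tableau E) t∈E | ∈-map⁻ (tableau F) t∈F
  ... | c , c∈ , refl | d , d∈ , eq = E≢F (choose⇒Increasing k n c∈) (choose⇒Increasing k n′ d∈) eq

constantRowsEmbedding : ∀ {k sh} → All (1 ≤_) sh → Embedding k (length sh) sh
constantRowsEmbedding {sh = sh} sh-pos = record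
  { tableau      = constantRows sh
  ; injective    = λ (c-len , _) (d-len , _) → constantRows-injective sh-pos c-len d-len
  ; semistandard = constantRows-∈-SSYTs
  ; occurs       = λ (c-len , _) → constantRows-occurs sh-pos c-len
  }

splitRowEmbedding : ∀ {k a b λ₁ rest} → a + b ≡ λ₁ → 1 ≤ a → 1 ≤ b → All (1 ≤_) rest →
                    Embedding k (2 + length rest) (λ₁ ∷ rest)
splitRowEmbedding {a = suc a} {suc b} {rest = rest} a+b≡λ₁ (s≤s z≤n) (s≤s z≤n) rest-pos = record
  { tableau      = splitFirstRow (suc a) (suc b) rest
  ; injective    = splitFirstRow-injective rest-pos
  ; semistandard = splitFirstRow-∈-SSYTs a+b≡λ₁
  ; occurs       = splitFirstRow-occurs rest-pos
  }

replicate-≡-∷ʳ : ∀ n {x y z : ℕ} → replicate (suc n) x ≡ replicate n y ++ replicate 1 z → x ≡ z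
replicate-≡-∷ʳ zero    eq = ∷-injectiveˡ eq
replicate-≡-∷ʳ (suc n) eq = replicate-≡-∷ʳ n (∷-injectiveʳ eq)

≤∸⇒+≤ : ∀ {ℓ n o} → 1 ≤ ℓ → ℓ ≤ n ∸ o → ℓ + o ≤ n
≤∸⇒+≤ {ℓ} {n} {o} 1≤ℓ ℓ≤n∸o = m≤o∸n⇒m+n≤o ℓ (<⇒≤ (m∸n≢0⇒n<m n∸o≢0)) ℓ≤n∸o
  where
  n∸o≢0 : n ∸ o ≢ 0
  n∸o≢0 n∸o≡0 = <⇒≱ (≤-trans 1≤ℓ (≤-trans ℓ≤n∸o (≤-reflexive n∸o≡0))) z≤n

Σexcess≥-oneRow : ∀ m p → suc m * m ≤ Σexcess (suc m) (3 + p ∷ [])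
Σexcess≥-oneRow m p = begin
  suc m * m                           ≡⟨ 2*[1+n]C2≡[1+n]*n m ⟨
  X + (X + 0)                         ≡⟨ cong (X +_) (+-identityʳ X) ⟩
  X + X                               ≡⟨ cong₂ _+_ (*-identityʳ X) (*-identityʳ X) ⟨
  X * 1 + X * 1                       ≤⟨ Σexcess≥embeddings lastSplit headSplit lastSplit≢headSplit ⟩
  Σexcess (suc m) (3 + p ∷ [])        ∎
  where
  open ≤-Reasoning
  X = suc m C 2
  lastSplit headSplit : Embedding (suc m) 2 (3 + p ∷ [])
  lastSplit = splitRowEmbedding {a = 2 + p} {b = 1} (+-comm (2 + p) 1) (s≤s z≤n) (s≤s z≤n) []
  headSplit = splitRowEmbedding {a = 1} {b = 2 + p} refl (s≤s z≤n) (s≤s z≤n) []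
  -- the rows are  x x ⋯ x x′  and  y y′ ⋯ y′,  with y < y′
  lastSplit≢headSplit : ∀ {c d} → Increasing (suc m) 2 c → Increasing (suc m) 2 d →
                        tableau lastSplit c ≢ tableau headSplit d
  lastSplit≢headSplit {x ∷ x′ ∷ _} {y ∷ y′ ∷ _} _ (_ , _ , y<y′ ∷ _) eq with ∷-injectiveˡ eq
  ... | row≡ = <-irrefl (trans (sym (∷-injectiveˡ row≡)) (∷-injectiveˡ (∷-injectiveʳ row≡))) y<y′
  lastSplit≢headSplit {[]}        (() , _) _ _
  lastSplit≢headSplit {_ ∷ []}    (() , _) _ _
  lastSplit≢headSplit {_ ∷ _ ∷ _} {[]}     _ (() , _) _
  lastSplit≢headSplit {_ ∷ _ ∷ _} {_ ∷ []} _ (() , _) _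

Σexcess≥-twoRows : ∀ m p {q} → 1 ≤ q → 4 ≤ suc m → suc m * m ≤ Σexcess (suc m) (2 + p ∷ q ∷ [])
Σexcess≥-twoRows m p {q} 1≤q 4≤k = begin
  suc m * m                           ≤⟨ n*[n∸1]≤nC2+nC3*2 4≤k ⟩
  (suc m C 2) * 1 + (suc m C 3) * 2   ≤⟨ Σexcess≥embeddings constant split constant≢split ⟩
  Σexcess (suc m) (2 + p ∷ q ∷ [])    ∎
  where
  open ≤-Reasoning
  constant : Embedding (suc m) 2 (2 + p ∷ q ∷ [])
  constant = constantRowsEmbedding (s≤s z≤n ∷ 1≤q ∷ [])
  split : Embedding (suc m) 3 (2 + p ∷ q ∷ [])
  split = splitRowEmbedding {a = suc p} {b = 1} (+-comm (suc p) 1) (s≤s z≤n) (s≤s z≤n) (1≤q ∷ [])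
  -- the first rows are  x x ⋯ x  and  y ⋯ y y′,  with y < y′
  constant≢split : ∀ {c d} → Increasing (suc m) 2 c → Increasing (suc m) 3 d →
                   tableau constant c ≢ tableau split d
  constant≢split {x ∷ _ ∷ _} {y ∷ y′ ∷ _} _ (_ , _ , y<y′ ∷ _) eq with ∷-injectiveˡ eq
  ... | row≡ = <-irrefl (trans (sym (∷-injectiveˡ row≡)) (replicate-≡-∷ʳ (suc p) row≡)) y<y′
  constant≢split {[]}     (() , _) _ _
  constant≢split {_ ∷ []} (() , _) _ _
  constant≢split {_ ∷ _ ∷ _} {[]}     _ (() , _) _
  constant≢split {_ ∷ _ ∷ _} {_ ∷ []} _ (() , _) _

Σexcess≥-manyRows : ∀ {m} sh → All (1 ≤_) sh → 3 ≤ length sh → length sh + 2 ≤ suc m →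
                    suc m * m ≤ Σexcess (suc m) sh
Σexcess≥-manyRows sh sh-pos 3≤ℓ ℓ+2≤k =
  ≤-trans (n*[n∸1]≤nCℓ*[ℓ∸1] 3≤ℓ ℓ+2≤k) (Σexcess≥embedding (constantRowsEmbedding sh-pos))

Σexcess≥k*[k∸1] : ∀ {m} sh → All (1 ≤_) sh → Linked _≥_ sh → 1 ≤ length sh → length sh ≤ suc m ∸ 2 →
                  sh ≢ 1 ∷ [] → sh ≢ 2 ∷ [] → sh ≢ 1 ∷ 1 ∷ [] → suc m * m ≤ Σexcess (suc m) sh
Σexcess≥k*[k∸1] (1 ∷ [])                 _ _ _ _ ≢[1] _ _ = ⊥-elim (≢[1] refl)
Σexcess≥k*[k∸1] (2 ∷ [])                 _ _ _ _ _ ≢[2] _ = ⊥-elim (≢[2] refl)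
Σexcess≥k*[k∸1] {m} (suc (suc (suc p)) ∷ []) _ _ _ _ _ _ _ = Σexcess≥-oneRow m p
Σexcess≥k*[k∸1] (1 ∷ 1 ∷ [])             _ _ _ _ _ _ ≢[1,1] = ⊥-elim (≢[1,1] refl)
Σexcess≥k*[k∸1] (1 ∷ zero ∷ [])          (_ ∷ () ∷ [])
Σexcess≥k*[k∸1] (1 ∷ suc (suc q) ∷ [])   _ (s≤s () ∷ _)
Σexcess≥k*[k∸1] {m} (suc (suc p) ∷ q ∷ []) (_ ∷ 1≤q ∷ []) _ 1≤ℓ ℓ≤k∸2 _ _ _ =
  Σexcess≥-twoRows m p 1≤q (≤∸⇒+≤ 1≤ℓ ℓ≤k∸2)
Σexcess≥k*[k∸1] sh@(_ ∷ _ ∷ _ ∷ _)       sh-pos _ 1≤ℓ ℓ≤k∸2 _ _ _ =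
  Σexcess≥-manyRows sh sh-pos (s≤s (s≤s (s≤s z≤n))) (≤∸⇒+≤ 1≤ℓ ℓ≤k∸2)
Σexcess≥k*[k∸1] []                       _ _ ()
Σexcess≥k*[k∸1] (zero ∷ _)               (() ∷ _)

lemma4p4 : (λp : Partition) (k : ℕ) → 3 ≤ k →
    1 ≤ len λp → len λp ≤ k ∸ 2 →
    ¬ (parts λp ≡ 1 ∷ []) → ¬ (parts λp ≡ 2 ∷ []) → ¬ (parts λp ≡ 1 ∷ 1 ∷ []) →
    k * schurOnes λp (k ∸ 1) + k * (k ∸ 1) ≤ (k ∸ 1) * schurOnes λp k
lemma4p4 _                                     zero    ()
lemma4p4 (mkPartition []         _        _) (suc m) _ ()
lemma4p4 (mkPartition (zero ∷ _) (() ∷ _) _) (suc m)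
lemma4p4 λp@(mkPartition (suc p ∷ sh) sh-pos sh-dec) (suc m) _ 1≤ℓ ℓ≤k∸2 ≢[1] ≢[2] ≢[1,1] = begin
  suc m * schurOnes λp m + suc m * m
    ≤⟨ +-monoʳ-≤ (suc m * schurOnes λp m)
         (Σexcess≥k*[k∸1] (suc p ∷ sh) sh-pos sh-dec 1≤ℓ ℓ≤k∸2 ≢[1] ≢[2] ≢[1,1]) ⟩
  suc m * schurOnes λp m + Σexcess (suc m) (suc p ∷ sh)
    ≡⟨ double-count m p sh ⟩
  m * schurOnes λp (suc m) ∎
  where open ≤-Reasoning
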